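{- For every term $t$ in $T$ there exists a positive integer $p$ such that $x^{[n]}\equiv_{\mathtt{ALD}}t*x^{[n-p]}$ holds for all sufficiently large $n$.
   Context: $T$ is the set of terms built from the single variable $x$ using two binary operation symbols $*$ and $\circ$. Right vines: $x^{[1]}=x$ and $x^{[n]}=x*x^{[n-1]}$ for $n\ge2$. $\equiv_{\mathtt{ALD}}$ is the congruence on terms generated by all substitution instances of the three laws $x*(y*z)=(x*y)*(x*z)$, $x*(y\circ z)=(x*y)\circ(x*z)$, $x*(y*z)=(x\circ y)*z$. -}

module Defs where

open import Data.Nat using (ℕ; zero; suc)

data Term : Set where
  x   : Term
  _⋆_ : Term → Term → Term
  _∘_ : Term → Term → Term

infixr 6 _⋆_
infixr 6 _∘_

-- Right vines: x^[1] = x, x^[n] = x ⋆ x^[n-1] for n ≥ 2.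
-- The value at 0 is a convention only (set to x); the statement never uses it.
vine : ℕ → Term
vine zero          = x
vine (suc zero)    = x
vine (suc (suc n)) = x ⋆ vine (suc n)

data _≈ALD_ : Term → Term → Set where
  ld₁  : ∀ a b c → (a ⋆ (b ⋆ c)) ≈ALD ((a ⋆ b) ⋆ (a ⋆ c))
  ld₂  : ∀ a b c → (a ⋆ (b ∘ c)) ≈ALD ((a ⋆ b) ∘ (a ⋆ c))
  ld₃  : ∀ a b c → (a ⋆ (b ⋆ c)) ≈ALD ((a ∘ b) ⋆ c)
  refl  : ∀ {a} → a ≈ALD a
  sym   : ∀ {a b} → a ≈ALD b → b ≈ALD a
  trans : ∀ {a b c} → a ≈ALD b → b ≈ALD c → a ≈ALD c
  cong⋆ : ∀ {a a′ b b′} → a ≈ALD a′ → b ≈ALD b′ → (a ⋆ b) ≈ALD (a′ ⋆ b′)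
  cong∘ : ∀ {a a′ b b′} → a ≈ALD a′ → b ≈ALD b′ → (a ∘ b) ≈ALD (a′ ∘ b′)

infix 4 _≈ALD_

-- Induction on t: x shifts vines by 1 by definition of the vines. If t₁, t₂ shift them by
-- p₁, p₂ (from some threshold on), the third law (t₁ ∘ t₂) ⋆ v ≈ t₁ ⋆ (t₂ ⋆ v) makes t₁ ∘ t₂
-- shift by p₁ + p₂, and the first law, read as (t₁ ⋆ t₂) ⋆ (t₁ ⋆ v) ≈ t₁ ⋆ (t₂ ⋆ v) together
-- with t₁ ⋆ vine m ≈ vine (p₁ + m), makes t₁ ⋆ t₂ shift by p₂.
module Submission where

open import Defs
open import Data.Nat using (ℕ; suc; _+_; _∸_; _⊔_; _≤_; _<_; s≤s; z≤n)
open import Data.Nat.Properties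
  using (+-assoc; +-commutativeSemigroup; m+n∸m≡n; m+[n∸m]≡n; m+n≤o⇒n≤o; m+n≤o⇒m≤o∸n;
         m≤n⇒m≤o+n; m≤n⇒m≤n+o; m⊔n≤o⇒m≤o; m⊔n≤o⇒n≤o; m<n+m; <⇒≤)
open import Algebra.Properties.CommutativeSemigroup +-commutativeSemigroup using (x∙yz≈y∙xz)
open import Data.Product using (Σ; ∃-syntax; _×_; _,_)
open import Level using (0ℓ)
open import Relation.Binary.Bundles using (Setoid)
import Relation.Binary.PropositionalEquality as ≡
import Relation.Binary.Reasoning.Setoid as SetoidReasoning

≈ALD-setoid : Setoid 0ℓ 0ℓ
≈ALD-setoid = record
  { Carrier       = Term
  ; _≈_           = _≈ALD_
  ; isEquivalence = record { refl = refl ; sym = sym ; trans = trans }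
  }

open SetoidReasoning ≈ALD-setoid

from-shifted-threshold : ∀ {P : ℕ → Set} k N →
  (∀ m → N ≤ m → P (k + m)) → ∀ n → N + k ≤ n → P n
from-shifted-threshold {P} k N h n N+k≤n =
  ≡.subst P (m+[n∸m]≡n (m+n≤o⇒n≤o N N+k≤n)) (h (n ∸ k) (m+n≤o⇒m≤o∸n N N+k≤n))

VineShift : Term → ℕ → Set
VineShift t p = Σ ℕ λ N → ∀ m → N ≤ m → vine (p + m) ≈ALD t ⋆ vine m

x-vineShift : VineShift x 1
x-vineShift = 1 , λ { (suc m) _ → refl }

∘-vineShift : ∀ {t₁ t₂ p₁ p₂} →
  VineShift t₁ p₁ → VineShift t₂ p₂ → VineShift (t₁ ∘ t₂) (p₁ + p₂)
∘-vineShift {t₁} {t₂} {p₁} {p₂} (N₁ , h₁) (N₂ , h₂) = N₁ ⊔ N₂ , shift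
  where
    shift : ∀ m → N₁ ⊔ N₂ ≤ m → vine (p₁ + p₂ + m) ≈ALD (t₁ ∘ t₂) ⋆ vine m
    shift m N≤m = begin
      vine (p₁ + p₂ + m)     ≡⟨ ≡.cong vine (+-assoc p₁ p₂ m) ⟩
      vine (p₁ + (p₂ + m))   ≈⟨ h₁ (p₂ + m) (m≤n⇒m≤o+n p₂ (m⊔n≤o⇒m≤o N₁ N₂ N≤m)) ⟩
      t₁ ⋆ vine (p₂ + m)     ≈⟨ cong⋆ refl (h₂ m (m⊔n≤o⇒n≤o N₁ N₂ N≤m)) ⟩
      t₁ ⋆ (t₂ ⋆ vine m)     ≈⟨ ld₃ t₁ t₂ (vine m) ⟩
      (t₁ ∘ t₂) ⋆ vine m     ∎

⋆-vineShift : ∀ {t₁ t₂ p₁ p₂} →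
  VineShift t₁ p₁ → VineShift t₂ p₂ → VineShift (t₁ ⋆ t₂) p₂
⋆-vineShift {t₁} {t₂} {p₁} {p₂} (N₁ , h₁) (N₂ , h₂) =
  N₁ ⊔ N₂ + p₁ , from-shifted-threshold p₁ (N₁ ⊔ N₂) shift
  where
    shift : ∀ m → N₁ ⊔ N₂ ≤ m → vine (p₂ + (p₁ + m)) ≈ALD (t₁ ⋆ t₂) ⋆ vine (p₁ + m)
    shift m N≤m = begin
      vine (p₂ + (p₁ + m))        ≡⟨ ≡.cong vine (x∙yz≈y∙xz p₂ p₁ m) ⟩
      vine (p₁ + (p₂ + m))        ≈⟨ h₁ (p₂ + m) (m≤n⇒m≤o+n p₂ N₁≤m) ⟩
      t₁ ⋆ vine (p₂ + m)          ≈⟨ cong⋆ refl (h₂ m (m⊔n≤o⇒n≤o N₁ N₂ N≤m)) ⟩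
      t₁ ⋆ (t₂ ⋆ vine m)          ≈⟨ ld₁ t₁ t₂ (vine m) ⟩
      (t₁ ⋆ t₂) ⋆ (t₁ ⋆ vine m)   ≈⟨ cong⋆ refl (h₁ m N₁≤m) ⟨
      (t₁ ⋆ t₂) ⋆ vine (p₁ + m)   ∎
      where N₁≤m = m⊔n≤o⇒m≤o N₁ N₂ N≤m

vineShift : ∀ t → ∃[ p ] (1 ≤ p × VineShift t p)
vineShift x = 1 , s≤s z≤n , x-vineShift
vineShift (t₁ ⋆ t₂) with vineShift t₁ | vineShift t₂
... | _ , _ , s₁ | p₂ , 1≤p₂ , s₂ = p₂ , 1≤p₂ , ⋆-vineShift s₁ s₂
vineShift (t₁ ∘ t₂) with vineShift t₁ | vineShift t₂
... | p₁ , 1≤p₁ , s₁ | p₂ , _ , s₂ = p₁ + p₂ , m≤n⇒m≤n+o p₂ 1≤p₁ , ∘-vineShift s₁ s₂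

lemma3p3 : (t : Term) →
    Σ ℕ (λ p → (1 ≤ p) × Σ ℕ (λ N → (p < N) ×
      ((n : ℕ) → N ≤ n → vine n ≈ALD (t ⋆ vine (n ∸ p)))))
lemma3p3 t with vineShift t
... | p , 1≤p , N , h = p , 1≤p , suc N + p , m<n+m p (s≤s z≤n) ,
  from-shifted-threshold p (suc N) shift
  where
    shift : ∀ m → suc N ≤ m → vine (p + m) ≈ALD t ⋆ vine (p + m ∸ p)
    shift m N<m = ≡.subst (λ k → vine (p + m) ≈ALD t ⋆ vine k) (≡.sym (m+n∸m≡n p m))
                          (h m (<⇒≤ N<m))
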